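{- Let $\alpha\neq 0$ and $\beta$ be complex constants, $\{a_i\},\{b_i\},\{c_i\},\{d_i\}$ ($i\in\mathbb{Z}$) complex sequences (with $b_j,c_j,d_j\ne0$) and $m,n\ge0$ integers, such that for all $-n\le j\le m$ the quantities $(a_j+c_j)(a_j+\frac{\beta}{\alpha c_j})$, $(a_j+d_j)(a_j+\frac{\beta}{\alpha d_j})$, $(b_j-c_j)(1-\frac{\beta}{\alpha b_jc_j})$, $(b_j-d_j)(1-\frac{\beta}{\alpha b_jd_j})$ are nonzero. Then $$\sum_{k=-n}^{m}(a_k+b_k)\Big(a_k+\frac{\beta}{\alpha b_k}\Big)(c_k-d_k)\Big(1-\frac{\beta}{\alpha c_kd_k}\Big)\frac{\prod_{j=1}^{k-1}(a_j+c_j)(a_j+\frac{\beta}{\alpha c_j})}{\prod_{j=1}^{k}(a_j+d_j)(a_j+\frac{\beta}{\alpha d_j})}\frac{\prod_{j=1}^{k-1}(b_j-d_j)(1-\frac{\beta}{\alpha b_jd_j})}{\prod_{j=1}^{k}(b_j-c_j)(1-\frac{\beta}{\alpha b_jc_j})}$$ $$=\frac{\prod_{j=1}^{m}(a_j+c_j)(a_j+\frac{\beta}{\alpha c_j})}{\prod_{j=1}^{m}(a_j+d_j)(a_j+\frac{\beta}{\alpha d_j})}\frac{\prod_{j=1}^{m}(b_j-d_j)(1-\frac{\beta}{\alpha b_jd_j})}{\prod_{j=1}^{m}(b_j-c_j)(1-\frac{\beta}{\alpha b_jc_j})}-\frac{\prod_{j=-n}^{0}(a_j+d_j)(a_j+\frac{\beta}{\alpha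 d_j})}{\prod_{j=-n}^{0}(a_j+c_j)(a_j+\frac{\beta}{\alpha c_j})}\frac{\prod_{j=-n}^{0}(b_j-c_j)(1-\frac{\beta}{\alpha b_jc_j})}{\prod_{j=-n}^{0}(b_j-d_j)(1-\frac{\beta}{\alpha b_jd_j})}.$$
   Context: Products over integer ranges use the convention: for integers $k,m$, $$\prod_{j=k}^{m}A_j=\begin{cases}A_kA_{k+1}\cdots A_m,& m\ge k,\\ 1,& m=k-1,\\ (A_{m+1}A_{m+2}\cdots A_{k-1})^{ -1},& m\le k-2.\end{cases}$$ (The paper denotes the constants $\alpha,\beta$ by $a,b$.) This is the specialization of the general summation formula to $f(x,y)=(x+y)(x+\frac{\beta}{\alpha y})$, $g(x,y)=(x-y)(1-\frac{\beta}{\alpha xy})$. -}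

module Defs where

open import Level using (Level; _⊔_) renaming (suc to lsuc)
open import Algebra.Bundles using (CommutativeRing)
open import Data.Nat using (ℕ; zero; suc)
open import Data.Integer using (ℤ; +_; -[1+_]) renaming (-_ to -ℤ_; _+_ to _+ℤ_; _-_ to _-ℤ_)
open import Relation.Nullary using (¬_)

-- A field: a commutative ring with 0 ≠ 1 and a (total) inverse operation
-- that is a genuine multiplicative inverse on every nonzero element
-- (the value of 0⁻¹ is unspecified and is never used under the hypotheses).
record Field (c ℓ : Level) : Set (lsuc (c ⊔ ℓ)) where
  field
    commutativeRing : CommutativeRing c ℓ
  open CommutativeRing commutativeRing public
  field
    _⁻¹      : Carrier → Carrier
    ⁻¹-inverseʳ : ∀ x → ¬ (x ≈ 0#) → (x * (x ⁻¹)) ≈ 1#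
    0≉1      : ¬ (0# ≈ 1#)

  infix 8 _⁻¹

  _/_ : Carrier → Carrier → Carrier
  x / y = x * (y ⁻¹)

  infixl 7 _/_

  prodUp : (ℤ → Carrier) → ℤ → ℕ → Carrier
  prodUp A k zero    = 1#
  prodUp A k (suc l) = A k * prodUp A (k +ℤ + 1) l

  -- ∏_{j=k}^{m} A j with the paper's convention:
  --   m ≥ k     : A k ⋯ A m
  --   m = k - 1 : 1
  --   m ≤ k - 2 : (A (m+1) ⋯ A (k-1))⁻¹
  prodZ : (ℤ → Carrier) → ℤ → ℤ → Carrier
  prodZ A k m with (m -ℤ k) +ℤ + 1
  ... | + len      = prodUp A k len
  ... | -[1+ t ]   = (prodUp A (m +ℤ + 1) (suc t)) ⁻¹

  sumUp : (ℤ → Carrier) → ℤ → ℕ → Carrier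
  sumUp A k zero    = 0#
  sumUp A k (suc l) = A k + sumUp A (k +ℤ + 1) l

  sumRange : (ℤ → Carrier) → ℕ → ℕ → Carrier
  sumRange A m n = sumUp A (-ℤ (+ n)) (suc (m Data.Nat.+ n))

  fα : Carrier → Carrier → Carrier → Carrier → Carrier
  fα α β x y = (x + y) * (x + β / (α * y))

  gα : Carrier → Carrier → Carrier → Carrier → Carrier
  gα α β x y = (x - y) * (1# - β / (α * x * y))

{-# OPTIONS --safe #-}

-- With f = fα α β and g = gα α β, clearing denominators (y f(x,y) = (x + y)(xy + β/α) and
-- xy g(x,y) = (x − y)(xy − β/α)) turns the three-term relation
--   f(a,c) g(b,d) − f(a,d) g(b,c) = f(a,b) g(c,d)
-- into a polynomial identity.  Let R(k) be the product ratio on the right-hand side with upper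
-- index k.  Since ∏_{j=1}^{k} A_j = (∏_{j=1}^{k−1} A_j) A_k for every k (this is what the
-- convention for reversed ranges guarantees), the three-term relation makes the k-th summand
-- equal to R(k) − R(k−1).  The sum telescopes to R(m) − R(−n−1), and R(−n−1) is the subtracted
-- term because ∏_{j=1}^{−n−1} A_j = (∏_{j=−n}^{0} A_j)⁻¹.

module Submission where

open import Defs
open import Data.Nat using (ℕ)
open import Data.Integer using (ℤ; +_; _≤_) renaming (-_ to -ℤ_; _+_ to _+ℤ_; _-_ to _-ℤ_)
open import Relation.Nullary using (¬_)
open import Data.Product using (_×_)

open import Algebra.Bundles using (CommutativeRing)
import Algebra.Solver.Ring.AlmostCommutativeRing as ACR
open import Data.Integer using (-[1+_]; _⊖_; _◃_; sign; ∣_∣)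
import Data.Integer as ℤ
import Data.Integer.Properties as ℤ
open import Data.Integer.Tactic.RingSolver using (solve-∀)
open import Data.Maybe using (Maybe)
import Data.Maybe as Maybe
open import Data.Nat using (zero; suc) renaming (_≤_ to _≤ℕ_; _<_ to _<ℕ_)
import Data.Nat as ℕ
import Data.Nat.Properties as ℕ
open import Data.Product using (_,_; proj₁; proj₂)
open import Data.Sign using (Sign)
import Data.Sign as Sign
open import Function using (_∘_)
open import Relation.Binary.Consequences using (dec⇒weaklyDec)
import Relation.Binary.PropositionalEquality as ≡

-- The canonical map ℤ → R makes ℤ a coefficient ring for Algebra.Solver.Ring over any commutative
-- ring R; integer coefficients are what lets the solver cancel terms such as x - x.
module ℤ-CoefficientRingSolver {c ℓ} (R : CommutativeRing c ℓ) where
  open CommutativeRing R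
  open import Algebra.Properties.Ring ring
  open import Algebra.Properties.Semiring.Mult.TCOptimised semiring
    using (×-homo-+; ×1-homo-*; 1+×) renaming (_×_ to _×′_)
  open import Algebra.Properties.CommutativeSemigroup *-commutativeSemigroup using (interchange)
  open import Algebra.Properties.CommutativeSemigroup +-commutativeSemigroup
    using () renaming (interchange to +-interchange)
  open import Relation.Binary.Reasoning.Setoid setoid

  fromℤ : ℤ → Carrier
  fromℤ (+ n)      = n ×′ 1#
  fromℤ (-[1+ n ]) = - (suc n ×′ 1#)

  fromSign : Sign → Carrier
  fromSign Sign.+ = 1#
  fromSign Sign.- = - 1#

  ⊖-homo : ∀ m n → fromℤ (m ⊖ n) ≈ m ×′ 1# - n ×′ 1#
  ⊖-homo m       zero    = trans (sym (+-identityʳ _)) (+-congˡ (sym -0#≈0#))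
  ⊖-homo zero    (suc n) = sym (+-identityˡ _)
  ⊖-homo (suc m) (suc n) = begin
    fromℤ (suc m ⊖ suc n)               ≡⟨ ≡.cong fromℤ (ℤ.[1+m]⊖[1+n]≡m⊖n m n) ⟩
    fromℤ (m ⊖ n)                       ≈⟨ ⊖-homo m n ⟩
    m ×′ 1# - n ×′ 1#                   ≈⟨ +-identityˡ _ ⟨
    0# + (m ×′ 1# - n ×′ 1#)            ≈⟨ +-congʳ (-‿inverseʳ 1#) ⟨
    (1# - 1#) + (m ×′ 1# - n ×′ 1#)     ≈⟨ +-interchange _ _ _ _ ⟨
    (1# + m ×′ 1#) + (- 1# - n ×′ 1#)   ≈⟨ +-congˡ (-‿+-comm 1# (n ×′ 1#)) ⟩
    (1# + m ×′ 1#) - (1# + n ×′ 1#)     ≈⟨ +-cong (1+× m 1#) (-‿cong (1+× n 1#)) ⟨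
    suc m ×′ 1# - suc n ×′ 1#           ∎

  +-homo : ∀ i j → fromℤ (i ℤ.+ j) ≈ fromℤ i + fromℤ j
  +-homo (+ m)    (+ n)    = ×-homo-+ 1# m n
  +-homo (+ m)    -[1+ n ] = ⊖-homo m (suc n)
  +-homo -[1+ m ] (+ n)    = trans (⊖-homo n (suc m)) (+-comm _ _)
  +-homo -[1+ m ] -[1+ n ] = begin
    - (suc (suc (m ℕ.+ n)) ×′ 1#)       ≡⟨ ≡.cong (λ k → - (suc k ×′ 1#)) (ℕ.+-suc m n) ⟨
    - ((suc m ℕ.+ suc n) ×′ 1#)         ≈⟨ -‿cong (×-homo-+ 1# (suc m) (suc n)) ⟩
    - (suc m ×′ 1# + suc n ×′ 1#)       ≈⟨ -‿+-comm _ _ ⟨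
    - (suc m ×′ 1#) + - (suc n ×′ 1#)   ∎

  ◃-homo : ∀ s n → fromℤ (s ◃ n) ≈ fromSign s * n ×′ 1#
  ◃-homo s      zero    = sym (zeroʳ _)
  ◃-homo Sign.+ (suc n) = sym (*-identityˡ _)
  ◃-homo Sign.- (suc n) = sym (-1*x≈-x _)

  sign-homo : ∀ s t → fromSign (s Sign.* t) ≈ fromSign s * fromSign t
  sign-homo Sign.+ t      = sym (*-identityˡ _)
  sign-homo Sign.- Sign.+ = sym (*-identityʳ _)
  sign-homo Sign.- Sign.- = sym (trans (-1*x≈-x (- 1#)) (-‿involutive 1#))

  sign-abs-homo : ∀ i → fromℤ i ≈ fromSign (sign i) * ∣ i ∣ ×′ 1#
  sign-abs-homo i = trans (reflexive (≡.cong fromℤ (≡.sym (ℤ.◃-inverse i)))) (◃-homo (sign i) ∣ i ∣)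

  *-homo : ∀ i j → fromℤ (i ℤ.* j) ≈ fromℤ i * fromℤ j
  *-homo i j = begin
    fromℤ (sign i Sign.* sign j ◃ ∣ i ∣ ℕ.* ∣ j ∣)
      ≈⟨ ◃-homo (sign i Sign.* sign j) (∣ i ∣ ℕ.* ∣ j ∣) ⟩
    fromSign (sign i Sign.* sign j) * (∣ i ∣ ℕ.* ∣ j ∣) ×′ 1#
      ≈⟨ *-cong (sign-homo (sign i) (sign j)) (×1-homo-* ∣ i ∣ ∣ j ∣) ⟩
    (fromSign (sign i) * fromSign (sign j)) * (∣ i ∣ ×′ 1# * ∣ j ∣ ×′ 1#)
      ≈⟨ interchange _ _ _ _ ⟩
    (fromSign (sign i) * ∣ i ∣ ×′ 1#) * (fromSign (sign j) * ∣ j ∣ ×′ 1#)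
      ≈⟨ *-cong (sign-abs-homo i) (sign-abs-homo j) ⟨
    fromℤ i * fromℤ j
      ∎

  -‿homo : ∀ i → fromℤ (ℤ.- i) ≈ - fromℤ i
  -‿homo (+ zero)  = sym -0#≈0#
  -‿homo (+ suc n) = refl
  -‿homo -[1+ n ]  = sym (-‿involutive _)

  homomorphism : ℤ.+-*-rawRing ACR.-Raw-AlmostCommutative⟶ ACR.fromCommutativeRing R
  homomorphism = record
    { ⟦_⟧    = fromℤ
    ; +-homo = +-homo
    ; *-homo = *-homo
    ; -‿homo = -‿homo
    ; 0-homo = refl
    ; 1-homo = refl
    }

  fromℤ-≟ : ∀ i j → Maybe (fromℤ i ≈ fromℤ j)
  fromℤ-≟ i j = Maybe.map (reflexive ∘ ≡.cong fromℤ) (dec⇒weaklyDec ℤ._≟_ i j)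

  open import Algebra.Solver.Ring ℤ.+-*-rawRing (ACR.fromCommutativeRing R) homomorphism fromℤ-≟ public

module FieldProperties {c ℓ} (F : Field c ℓ) where
  open Field F
  open ℤ-CoefficientRingSolver commutativeRing using (solve; _:=_; _:+_; _:-_; _:*_; con)
  open import Algebra.Properties.CommutativeSemigroup *-commutativeSemigroup
    using (interchange; xy∙z≈xz∙y)
  open import Relation.Binary.Reasoning.Setoid setoid

  ⁻¹-inverseˡ : ∀ {x} → x ≉ 0# → x ⁻¹ * x ≈ 1#
  ⁻¹-inverseˡ {x} x≉0 = trans (*-comm _ _) (⁻¹-inverseʳ x x≉0)

  1≉0 : 1# ≉ 0#
  1≉0 1≈0 = 0≉1 (sym 1≈0)

  ≉0-resp-≈ : ∀ {x y} → x ≈ y → x ≉ 0# → y ≉ 0#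
  ≉0-resp-≈ x≈y x≉0 y≈0 = x≉0 (trans x≈y y≈0)

  *-cancelˡ : ∀ {x y z} → x ≉ 0# → x * y ≈ x * z → y ≈ z
  *-cancelˡ {x} {y} {z} x≉0 xy≈xz = begin
    y                ≈⟨ *-identityˡ y ⟨
    1# * y           ≈⟨ *-congʳ (⁻¹-inverseˡ x≉0) ⟨
    (x ⁻¹ * x) * y   ≈⟨ *-assoc _ _ _ ⟩
    x ⁻¹ * (x * y)   ≈⟨ *-congˡ xy≈xz ⟩
    x ⁻¹ * (x * z)   ≈⟨ *-assoc _ _ _ ⟨
    (x ⁻¹ * x) * z   ≈⟨ *-congʳ (⁻¹-inverseˡ x≉0) ⟩
    1# * z           ≈⟨ *-identityˡ z ⟩
    z                ∎

  x*y≉0 : ∀ {x y} → x ≉ 0# → y ≉ 0# → x * y ≉ 0#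
  x*y≉0 {x} x≉0 y≉0 xy≈0 = y≉0 (*-cancelˡ x≉0 (trans xy≈0 (sym (zeroʳ x))))

  x*y≉0⇒x≉0 : ∀ {x y} → x * y ≉ 0# → x ≉ 0#
  x*y≉0⇒x≉0 {y = y} xy≉0 x≈0 = xy≉0 (trans (*-congʳ x≈0) (zeroˡ y))

  x*y≉0⇒y≉0 : ∀ {x y} → x * y ≉ 0# → y ≉ 0#
  x*y≉0⇒y≉0 {x} xy≉0 y≈0 = xy≉0 (trans (*-congˡ y≈0) (zeroʳ x))

  x⁻¹≉0 : ∀ {x} → x ≉ 0# → x ⁻¹ ≉ 0#
  x⁻¹≉0 {x} x≉0 x⁻¹≈0 = 0≉1 (begin
    0#           ≈⟨ zeroʳ x ⟨
    x * 0#       ≈⟨ *-congˡ x⁻¹≈0 ⟨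
    x * x ⁻¹     ≈⟨ ⁻¹-inverseʳ x x≉0 ⟩
    1#           ∎)

  ⁻¹-unique : ∀ {x y} → x ≉ 0# → x * y ≈ 1# → y ≈ x ⁻¹
  ⁻¹-unique {x} x≉0 xy≈1 = *-cancelˡ x≉0 (trans xy≈1 (sym (⁻¹-inverseʳ x x≉0)))

  -- The field axioms do not make _⁻¹ a congruence; it is one on nonzero elements.
  ⁻¹-cong : ∀ {x y} → x ≉ 0# → x ≈ y → x ⁻¹ ≈ y ⁻¹
  ⁻¹-cong {x} x≉0 x≈y =
    ⁻¹-unique (≉0-resp-≈ x≈y x≉0) (trans (*-congʳ (sym x≈y)) (⁻¹-inverseʳ x x≉0))

  ⁻¹-involutive : ∀ {x} → x ≉ 0# → x ⁻¹ ⁻¹ ≈ x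
  ⁻¹-involutive x≉0 = sym (⁻¹-unique (x⁻¹≉0 x≉0) (⁻¹-inverseˡ x≉0))

  ⁻¹-distrib-* : ∀ {x y} → x ≉ 0# → y ≉ 0# → (x * y) ⁻¹ ≈ x ⁻¹ * y ⁻¹
  ⁻¹-distrib-* {x} {y} x≉0 y≉0 = sym (⁻¹-unique (x*y≉0 x≉0 y≉0) (begin
    (x * y) * (x ⁻¹ * y ⁻¹)   ≈⟨ interchange x y (x ⁻¹) (y ⁻¹) ⟩
    (x * x ⁻¹) * (y * y ⁻¹)   ≈⟨ *-cong (⁻¹-inverseʳ x x≉0) (⁻¹-inverseʳ y y≉0) ⟩
    1# * 1#                   ≈⟨ *-identityˡ 1# ⟩
    1#                        ∎))

  /-cong : ∀ {x x′ y y′} → y′ ≉ 0# → x ≈ x′ → y ≈ y′ → x / y ≈ x′ / y′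
  /-cong y′≉0 x≈x′ y≈y′ = *-cong x≈x′ (sym (⁻¹-cong y′≉0 (sym y≈y′)))

  x*y/x≈y : ∀ {x y} → x ≉ 0# → x * y / x ≈ y
  x*y/x≈y {x} {y} x≉0 = begin
    x * y * x ⁻¹     ≈⟨ xy∙z≈xz∙y x y (x ⁻¹) ⟩
    x * x ⁻¹ * y     ≈⟨ *-congʳ (⁻¹-inverseʳ x x≉0) ⟩
    1# * y           ≈⟨ *-identityˡ y ⟩
    y                ∎

  x/[x*y]≈y⁻¹ : ∀ {x y} → x ≉ 0# → y ≉ 0# → x / (x * y) ≈ y ⁻¹
  x/[x*y]≈y⁻¹ {x} {y} x≉0 y≉0 = begin
    x * (x * y) ⁻¹        ≈⟨ *-congˡ (⁻¹-distrib-* x≉0 y≉0) ⟩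
    x * (x ⁻¹ * y ⁻¹)     ≈⟨ *-assoc _ _ _ ⟨
    x * x ⁻¹ * y ⁻¹       ≈⟨ *-congʳ (⁻¹-inverseʳ x x≉0) ⟩
    1# * y ⁻¹             ≈⟨ *-identityˡ _ ⟩
    y ⁻¹                  ∎

  [1/x]/[1/y]≈y/x : ∀ {x y} → y ≉ 0# → (1# / x) / (1# / y) ≈ y / x
  [1/x]/[1/y]≈y/x {x} {y} y≉0 = begin
    (1# * x ⁻¹) * (1# * y ⁻¹) ⁻¹   ≈⟨ *-cong (*-identityˡ _) (⁻¹-cong 1/y≉0 (*-identityˡ _)) ⟩
    x ⁻¹ * y ⁻¹ ⁻¹                 ≈⟨ *-congˡ (⁻¹-involutive y≉0) ⟩
    x ⁻¹ * y                       ≈⟨ *-comm _ _ ⟩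
    y / x                          ∎
    where
    1/y≉0 : 1# * y ⁻¹ ≉ 0#
    1/y≉0 = x*y≉0 1≉0 (x⁻¹≉0 y≉0)

  ratio-product-increment : ∀ {a b c d x y z w} → y ≉ 0# → w ≉ 0# → b ≉ 0# → d ≉ 0# →
    (a * c - b * d) * (x / (y * b)) * (z / (w * d))
      ≈ (x * a) / (y * b) * ((z * c) / (w * d)) - (x / y) * (z / w)
  ratio-product-increment {a} {b} {c} {d} {x} {y} {z} {w} y≉0 w≉0 b≉0 d≉0 = begin
    (a * c - b * d) * (x * (y * b) ⁻¹) * (z * (w * d) ⁻¹)
      ≈⟨ *-cong (*-congˡ (*-congˡ [yb]⁻¹)) (*-congˡ [wd]⁻¹) ⟩
    (a * c - b * d) * (x * (y ⁻¹ * b ⁻¹)) * (z * (w ⁻¹ * d ⁻¹))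
      ≈⟨ solve 12 (λ a b c d x y z w y′ b′ w′ d′ →
           (a :* c :- b :* d) :* (x :* (y′ :* b′)) :* (z :* (w′ :* d′))
           := (x :* a) :* (y′ :* b′) :* ((z :* c) :* (w′ :* d′))
              :- (x :* y′) :* (z :* w′) :* ((b :* b′) :* (d :* d′)))
           refl a b c d x y z w (y ⁻¹) (b ⁻¹) (w ⁻¹) (d ⁻¹) ⟩
    (x * a) * (y ⁻¹ * b ⁻¹) * ((z * c) * (w ⁻¹ * d ⁻¹))
      - (x / y) * (z / w) * ((b * b ⁻¹) * (d * d ⁻¹))
      ≈⟨ +-congˡ (-‿cong (*-congˡ bb⁻¹dd⁻¹≈1)) ⟩
    (x * a) * (y ⁻¹ * b ⁻¹) * ((z * c) * (w ⁻¹ * d ⁻¹)) - (x / y) * (z / w) * 1#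
      ≈⟨ +-cong (*-cong (*-congˡ (sym [yb]⁻¹)) (*-congˡ (sym [wd]⁻¹))) (-‿cong (*-identityʳ _)) ⟩
    (x * a) * (y * b) ⁻¹ * ((z * c) * (w * d) ⁻¹) - (x / y) * (z / w)
      ∎
    where
    [yb]⁻¹ : (y * b) ⁻¹ ≈ y ⁻¹ * b ⁻¹
    [yb]⁻¹ = ⁻¹-distrib-* y≉0 b≉0
    [wd]⁻¹ : (w * d) ⁻¹ ≈ w ⁻¹ * d ⁻¹
    [wd]⁻¹ = ⁻¹-distrib-* w≉0 d≉0
    bb⁻¹dd⁻¹≈1 : (b * b ⁻¹) * (d * d ⁻¹) ≈ 1#
    bb⁻¹dd⁻¹≈1 = trans (*-cong (⁻¹-inverseʳ b b≉0) (⁻¹-inverseʳ d d≉0)) (*-identityʳ 1#)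

  [k+1]+i≡k+[1+i] : ∀ k i → (k +ℤ + 1) +ℤ + i ≡.≡ k +ℤ + suc i
  [k+1]+i≡k+[1+i] k i = ℤ.+-assoc k (+ 1) (+ i)

  prodUp-+ : ∀ A k p q → prodUp A k (p ℕ.+ q) ≈ prodUp A k p * prodUp A (k +ℤ + p) q
  prodUp-+ A k zero    q = begin
    prodUp A k q                   ≡⟨ ≡.cong (λ j → prodUp A j q) (ℤ.+-identityʳ k) ⟨
    prodUp A (k +ℤ + 0) q          ≈⟨ *-identityˡ _ ⟨
    1# * prodUp A (k +ℤ + 0) q     ∎
  prodUp-+ A k (suc p) q = begin
    A k * prodUp A (k +ℤ + 1) (p ℕ.+ q)
      ≈⟨ *-congˡ (prodUp-+ A (k +ℤ + 1) p q) ⟩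
    A k * (prodUp A (k +ℤ + 1) p * prodUp A ((k +ℤ + 1) +ℤ + p) q)
      ≈⟨ *-assoc _ _ _ ⟨
    A k * prodUp A (k +ℤ + 1) p * prodUp A ((k +ℤ + 1) +ℤ + p) q
      ≡⟨ ≡.cong (λ j → A k * prodUp A (k +ℤ + 1) p * prodUp A j q) ([k+1]+i≡k+[1+i] k p) ⟩
    A k * prodUp A (k +ℤ + 1) p * prodUp A (k +ℤ + suc p) q
      ∎

  prodUp-suc : ∀ A k i → prodUp A k (suc i) ≈ prodUp A k i * A (k +ℤ + i)
  prodUp-suc A k i = begin
    prodUp A k (suc i)                   ≡⟨ ≡.cong (prodUp A k) (ℕ.+-comm 1 i) ⟩
    prodUp A k (i ℕ.+ 1)                 ≈⟨ prodUp-+ A k i 1 ⟩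
    prodUp A k i * (A (k +ℤ + i) * 1#)   ≈⟨ *-congˡ (*-identityʳ _) ⟩
    prodUp A k i * A (k +ℤ + i)          ∎

  prodUp-≉0 : ∀ A k len → (∀ i → i <ℕ len → A (k +ℤ + i) ≉ 0#) → prodUp A k len ≉ 0#
  prodUp-≉0 A k zero      A≉0 = 1≉0
  prodUp-≉0 A k (suc len) A≉0 = x*y≉0
    (≡.subst (λ j → A j ≉ 0#) (ℤ.+-identityʳ k) (A≉0 0 (ℕ.s≤s ℕ.z≤n)))
    (prodUp-≉0 A (k +ℤ + 1) len (λ i i<len →
      ≡.subst (λ j → A j ≉ 0#) (≡.sym ([k+1]+i≡k+[1+i] k i)) (A≉0 (suc i) (ℕ.s≤s i<len))))

  prodZ-+ : ∀ A k m {l} → (m -ℤ k) +ℤ + 1 ≡.≡ + l → prodZ A k m ≡.≡ prodUp A k l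
  prodZ-+ A k m eq with (m -ℤ k) +ℤ + 1
  ... | + _ = ≡.cong (prodUp A k) (ℤ.+-injective eq)

  prodZ--[1+] : ∀ A k m {t} → (m -ℤ k) +ℤ + 1 ≡.≡ -[1+ t ] →
    prodZ A k m ≡.≡ prodUp A (m +ℤ + 1) (suc t) ⁻¹
  prodZ--[1+] A k m eq with (m -ℤ k) +ℤ + 1
  ... | -[1+ _ ] = ≡.cong (λ s → prodUp A (m +ℤ + 1) (suc s) ⁻¹) (ℤ.-[1+-injective eq)

  prodZ-ratio : ∀ A j p i → prodUp A j p ≉ 0# →
    prodZ A (j +ℤ + p) ((j +ℤ + i) -ℤ + 1) ≈ prodUp A j i / prodUp A j p
  prodZ-ratio A j p i Πp≉0 = go _ ≡.refl
    where
    k m : ℤ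
    k = j +ℤ + p
    m = (j +ℤ + i) -ℤ + 1

    x≡y+[[[z+x]-1]-[z+y]]+1 : ∀ x y z → x ≡.≡ y +ℤ ((((z +ℤ x) -ℤ + 1) -ℤ (z +ℤ y)) +ℤ + 1)
    x≡y+[[[z+x]-1]-[z+y]]+1 = solve-∀

    x≡[x+e]-e : ∀ x e → x ≡.≡ (x +ℤ e) -ℤ e
    x≡[x+e]-e = solve-∀

    x-1+1≡x : ∀ x → (x -ℤ + 1) +ℤ + 1 ≡.≡ x
    x-1+1≡x = solve-∀

    i≡p+e : ∀ {e} → (m -ℤ k) +ℤ + 1 ≡.≡ e → + i ≡.≡ + p +ℤ e
    i≡p+e eq = ≡.trans (x≡y+[[[z+x]-1]-[z+y]]+1 (+ i) (+ p) j) (≡.cong (+ p +ℤ_) eq)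

    go : ∀ e → (m -ℤ k) +ℤ + 1 ≡.≡ e → prodZ A k m ≈ prodUp A j i / prodUp A j p
    go (+ l) eq = begin
      prodZ A k m
        ≡⟨ prodZ-+ A k m eq ⟩
      prodUp A k l
        ≈⟨ x*y/x≈y Πp≉0 ⟨
      prodUp A j p * prodUp A k l / prodUp A j p
        ≈⟨ *-congʳ (prodUp-+ A j p l) ⟨
      prodUp A j (p ℕ.+ l) / prodUp A j p
        ≡⟨ ≡.cong (λ q → prodUp A j q / prodUp A j p) i≡p+l ⟨
      prodUp A j i / prodUp A j p
        ∎
      where
      i≡p+l : i ≡.≡ p ℕ.+ l
      i≡p+l = ℤ.+-injective (i≡p+e eq)
    go -[1+ t ] eq = begin
      prodZ A k m
        ≡⟨ prodZ--[1+] A k m eq ⟩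
      prodUp A (m +ℤ + 1) (suc t) ⁻¹
        ≡⟨ ≡.cong (λ q → prodUp A q (suc t) ⁻¹) (x-1+1≡x (j +ℤ + i)) ⟩
      W ⁻¹
        ≈⟨ x/[x*y]≈y⁻¹ (x*y≉0⇒x≉0 Πi*W≉0) (x*y≉0⇒y≉0 Πi*W≉0) ⟨
      prodUp A j i / (prodUp A j i * W)
        ≈⟨ /-cong Πp≉0 refl (sym Πp≈Πi*W) ⟩
      prodUp A j i / prodUp A j p
        ∎
      where
      W : Carrier
      W = prodUp A (j +ℤ + i) (suc t)
      p≡i+[1+t] : p ≡.≡ i ℕ.+ suc t
      p≡i+[1+t] = ℤ.+-injective
        (≡.trans (x≡[x+e]-e (+ p) -[1+ t ]) (≡.cong (_-ℤ -[1+ t ]) (≡.sym (i≡p+e eq))))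
      Πp≈Πi*W : prodUp A j p ≈ prodUp A j i * W
      Πp≈Πi*W = trans (reflexive (≡.cong (prodUp A j) p≡i+[1+t])) (prodUp-+ A j i (suc t))
      Πi*W≉0 : prodUp A j i * W ≉ 0#
      Πi*W≉0 = ≉0-resp-≈ Πp≈Πi*W Πp≉0

  sumUp-telescope : ∀ (S : ℤ → Carrier) (T : ℕ → Carrier) k len →
    (∀ i → i <ℕ len → S (k +ℤ + i) ≈ T (suc i) - T i) → sumUp S k len ≈ T len - T 0
  sumUp-telescope S T k zero      step = sym (-‿inverseʳ _)
  sumUp-telescope S T k (suc len) step = begin
    S k + sumUp S (k +ℤ + 1) len
      ≈⟨ +-cong step₀ (sumUp-telescope S (T ∘ suc) (k +ℤ + 1) len step₊) ⟩
    (T 1 - T 0) + (T (suc len) - T 1)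
      ≈⟨ solve 3 (λ t₀ t₁ t → (t₁ :- t₀) :+ (t :- t₁) := t :- t₀)
                 refl (T 0) (T 1) (T (suc len)) ⟩
    T (suc len) - T 0
      ∎
    where
    step₀ : S k ≈ T 1 - T 0
    step₀ = trans (reflexive (≡.cong S (≡.sym (ℤ.+-identityʳ k)))) (step 0 (ℕ.s≤s ℕ.z≤n))
    step₊ : ∀ i → i <ℕ len → S ((k +ℤ + 1) +ℤ + i) ≈ T (suc (suc i)) - T (suc i)
    step₊ i i<len = trans (reflexive (≡.cong S ([k+1]+i≡k+[1+i] k i))) (step (suc i) (ℕ.s≤s i<len))

  module ThreeTermRelation (α β : Carrier) (α≉0 : α ≉ 0#) where

    fα-cleared : ∀ x {y} → y ≉ 0# → y * fα α β x y ≈ (x + y) * (x * y + β / α)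
    fα-cleared x {y} y≉0 = begin
      y * ((x + y) * (x + β * (α * y) ⁻¹))
        ≈⟨ *-congˡ (*-congˡ (+-congˡ (*-congˡ (⁻¹-distrib-* α≉0 y≉0)))) ⟩
      y * ((x + y) * (x + β * (α ⁻¹ * y ⁻¹)))
        ≈⟨ solve 5 (λ x y β α′ y′ → y :* ((x :+ y) :* (x :+ β :* (α′ :* y′)))
                                  := (x :+ y) :* (x :* y :+ (β :* α′) :* (y :* y′)))
                   refl x y β (α ⁻¹) (y ⁻¹) ⟩
      (x + y) * (x * y + β / α * (y * y ⁻¹))
        ≈⟨ *-congˡ (+-congˡ (*-congˡ (⁻¹-inverseʳ y y≉0))) ⟩
      (x + y) * (x * y + β / α * 1#)
        ≈⟨ *-congˡ (+-congˡ (*-identityʳ _)) ⟩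
      (x + y) * (x * y + β / α)
        ∎

    gα-cleared : ∀ {x y} → x ≉ 0# → y ≉ 0# →
      x * y * gα α β x y ≈ (x - y) * (x * y - β / α)
    gα-cleared {x} {y} x≉0 y≉0 = begin
      x * y * ((x - y) * (1# - β * (α * x * y) ⁻¹))
        ≈⟨ *-congˡ (*-congˡ (+-congˡ (-‿cong (*-congˡ [αxy]⁻¹)))) ⟩
      x * y * ((x - y) * (1# - β * (α ⁻¹ * x ⁻¹ * y ⁻¹)))
        ≈⟨ solve 6 (λ x y β α′ x′ y′ →
                      x :* y :* ((x :- y) :* (con (+ 1) :- β :* (α′ :* x′ :* y′)))
                      := (x :- y) :* (x :* y :- (β :* α′) :* (x :* x′) :* (y :* y′)))
                   refl x y β (α ⁻¹) (x ⁻¹) (y ⁻¹) ⟩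
      (x - y) * (x * y - β / α * (x * x ⁻¹) * (y * y ⁻¹))
        ≈⟨ *-congˡ (+-congˡ (-‿cong (*-cong (*-congˡ (⁻¹-inverseʳ x x≉0))
                                            (⁻¹-inverseʳ y y≉0)))) ⟩
      (x - y) * (x * y - β / α * 1# * 1#)
        ≈⟨ *-congˡ (+-congˡ (-‿cong (trans (*-identityʳ _) (*-identityʳ _)))) ⟩
      (x - y) * (x * y - β / α)
        ∎
      where
      [αxy]⁻¹ : (α * x * y) ⁻¹ ≈ α ⁻¹ * x ⁻¹ * y ⁻¹
      [αxy]⁻¹ = trans (⁻¹-distrib-* (x*y≉0 α≉0 x≉0) y≉0) (*-congʳ (⁻¹-distrib-* α≉0 x≉0))

    fα-gα-three-term : ∀ a {b c d} → b ≉ 0# → c ≉ 0# → d ≉ 0# →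
      fα α β a c * gα α β b d - fα α β a d * gα α β b c ≈ fα α β a b * gα α β c d
    fα-gα-three-term a {b} {c} {d} b≉0 c≉0 d≉0 = *-cancelˡ bcd≉0 (begin
      b * c * d * (f a c * g b d - f a d * g b c)
        ≈⟨ solve 7 (λ b c d fac gbd fad gbc →
                      b :* c :* d :* (fac :* gbd :- fad :* gbc)
                      := (c :* fac) :* (b :* d :* gbd) :- (d :* fad) :* (b :* c :* gbc))
                   refl b c d _ _ _ _ ⟩
      (c * f a c) * (b * d * g b d) - (d * f a d) * (b * c * g b c)
        ≈⟨ +-cong (*-cong (fα-cleared a c≉0) (gα-cleared b≉0 d≉0))
                  (-‿cong (*-cong (fα-cleared a d≉0) (gα-cleared b≉0 c≉0))) ⟩
      (a + c) * (a * c + u) * ((b - d) * (b * d - u)) - (a + d) * (a * d + u) * ((b - c) * (b * c - u))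
        ≈⟨ solve 5 (λ a b c d u →
                      (a :+ c) :* (a :* c :+ u) :* ((b :- d) :* (b :* d :- u))
                      :- (a :+ d) :* (a :* d :+ u) :* ((b :- c) :* (b :* c :- u))
                      := (a :+ b) :* (a :* b :+ u) :* ((c :- d) :* (c :* d :- u)))
                   refl a b c d u ⟩
      (a + b) * (a * b + u) * ((c - d) * (c * d - u))
        ≈⟨ *-cong (fα-cleared a b≉0) (gα-cleared c≉0 d≉0) ⟨
      (b * f a b) * (c * d * g c d)
        ≈⟨ solve 5 (λ b c d fab gcd → (b :* fab) :* (c :* d :* gcd) := b :* c :* d :* (fab :* gcd))
                   refl b c d _ _ ⟩
      b * c * d * (f a b * g c d)
        ∎)
      where
      f g : Carrier → Carrier → Carrier
      f = fα α β
      g = gα α β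
      u : Carrier
      u = β / α
      bcd≉0 : b * c * d ≉ 0#
      bcd≉0 = x*y≉0 (x*y≉0 b≉0 c≉0) d≉0

module _ {c ℓ} (F : Field c ℓ) where
  open Field F
  open FieldProperties F
  open import Algebra.Properties.CommutativeSemigroup *-commutativeSemigroup using (xy∙z≈xz∙y)
  open import Relation.Binary.Reasoning.Setoid setoid

  module SummationFormula
    (α β : Carrier) (α≉0 : α ≉ 0#) (a b c d : ℤ → Carrier)
    (b≉0 : ∀ j → b j ≉ 0#) (c≉0 : ∀ j → c j ≉ 0#) (d≉0 : ∀ j → d j ≉ 0#) (m n : ℕ)
    (H : ∀ j → -ℤ (+ n) ≤ j → j ≤ + m →
      fα α β (a j) (c j) ≉ 0# × fα α β (a j) (d j) ≉ 0# ×
      gα α β (b j) (c j) ≉ 0# × gα α β (b j) (d j) ≉ 0#)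
    where

    open ThreeTermRelation α β α≉0

    F₁ F₂ G₁ G₂ : ℤ → Carrier
    F₁ j = fα α β (a j) (c j)
    F₂ j = fα α β (a j) (d j)
    G₁ j = gα α β (b j) (c j)
    G₂ j = gα α β (b j) (d j)

    summand : ℤ → Carrier
    summand k = fα α β (a k) (b k) * gα α β (c k) (d k)
                * (prodZ F₁ (+ 1) (k -ℤ + 1) / prodZ F₂ (+ 1) k)
                * (prodZ G₂ (+ 1) (k -ℤ + 1) / prodZ G₁ (+ 1) k)

    base : ℤ
    base = -ℤ (+ n)

    in-range : ∀ i → i ≤ℕ m ℕ.+ n → base ≤ base +ℤ + i × base +ℤ + i ≤ + m
    in-range i i≤m+n =
      ℤ.i≤i+j base (+ i) ,
      ℤ.≤-trans (ℤ.+-monoʳ-≤ base (ℤ.+≤+ i≤m+n)) (ℤ.≤-reflexive base+[m+n]≡m)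
      where
      -y+[x+y]≡x : ∀ x y → -ℤ y +ℤ (x +ℤ y) ≡.≡ x
      -y+[x+y]≡x = solve-∀
      base+[m+n]≡m : base +ℤ + (m ℕ.+ n) ≡.≡ + m
      base+[m+n]≡m = ≡.trans (≡.cong (base +ℤ_) (ℤ.pos-+ m n)) (-y+[x+y]≡x (+ m) (+ n))

    -- P A i is ∏_{j=1}^{base+i-1} A j (prodZ≈P), written with products starting at base = -n
    -- so that only natural-number lengths occur.
    P : (ℤ → Carrier) → ℕ → Carrier
    P A i = prodUp A base i / prodUp A base (suc n)

    T : ℕ → Carrier
    T i = (P F₁ i / P F₂ i) * (P G₂ i / P G₁ i)

    NonzeroOnRange : (ℤ → Carrier) → Set ℓ
    NonzeroOnRange A = ∀ j → base ≤ j → j ≤ + m → A j ≉ 0#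

    module PartialProducts (A : ℤ → Carrier) (A≉0 : NonzeroOnRange A) where

      A[base+i]≉0 : ∀ i → i ≤ℕ m ℕ.+ n → A (base +ℤ + i) ≉ 0#
      A[base+i]≉0 i i≤m+n = A≉0 _ (proj₁ (in-range i i≤m+n)) (proj₂ (in-range i i≤m+n))

      prodUp[i]≉0 : ∀ i → i ≤ℕ suc (m ℕ.+ n) → prodUp A base i ≉ 0#
      prodUp[i]≉0 i i≤ =
        prodUp-≉0 A base i (λ j j<i → A[base+i]≉0 j (ℕ.s≤s⁻¹ (ℕ.≤-trans j<i i≤)))

      prodUp[1+n]≉0 : prodUp A base (suc n) ≉ 0#
      prodUp[1+n]≉0 = prodUp[i]≉0 (suc n) (ℕ.s≤s (ℕ.m≤n+m n m))

      P≉0 : ∀ i → i ≤ℕ suc (m ℕ.+ n) → P A i ≉ 0#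
      P≉0 i i≤ = x*y≉0 (prodUp[i]≉0 i i≤) (x⁻¹≉0 prodUp[1+n]≉0)

      P-suc : ∀ i → P A (suc i) ≈ P A i * A (base +ℤ + i)
      P-suc i = trans (*-congʳ (prodUp-suc A base i)) (xy∙z≈xz∙y _ _ _)

      prodZ≈P : ∀ i {k} → k ≡.≡ (base +ℤ + i) -ℤ + 1 → prodZ A (+ 1) k ≈ P A i
      prodZ≈P i ≡.refl =
        trans (reflexive (≡.cong (λ l → prodZ A l ((base +ℤ + i) -ℤ + 1)) 1≡base+[1+n]))
              (prodZ-ratio A base (suc n) i prodUp[1+n]≉0)
        where
        -x+[1+x]≡1 : ∀ x → -ℤ x +ℤ (+ 1 +ℤ x) ≡.≡ + 1
        -x+[1+x]≡1 = solve-∀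
        1≡base+[1+n] : + 1 ≡.≡ base +ℤ + suc n
        1≡base+[1+n] = ≡.sym (-x+[1+x]≡1 (+ n))

      prodZ≈P*A : ∀ i → prodZ A (+ 1) (base +ℤ + i) ≈ P A i * A (base +ℤ + i)
      prodZ≈P*A i = trans (prodZ≈P (suc i) (x+y≡[x+[1+y]]-1 base (+ i))) (P-suc i)
        where
        x+y≡[x+[1+y]]-1 : ∀ x y → x +ℤ y ≡.≡ (x +ℤ (+ 1 +ℤ y)) -ℤ + 1
        x+y≡[x+[1+y]]-1 = solve-∀

      prodZ[base,0]≡prodUp : prodZ A base (+ 0) ≡.≡ prodUp A base (suc n)
      prodZ[base,0]≡prodUp = prodZ-+ A base (+ 0) (0-[-x]+1≡1+x (+ n))
        where
        0-[-x]+1≡1+x : ∀ x → (+ 0 -ℤ (-ℤ x)) +ℤ + 1 ≡.≡ + 1 +ℤ x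
        0-[-x]+1≡1+x = solve-∀

    F₁≉0 : NonzeroOnRange F₁
    F₁≉0 j base≤j j≤m = proj₁ (H j base≤j j≤m)

    F₂≉0 : NonzeroOnRange F₂
    F₂≉0 j base≤j j≤m = proj₁ (proj₂ (H j base≤j j≤m))

    G₁≉0 : NonzeroOnRange G₁
    G₁≉0 j base≤j j≤m = proj₁ (proj₂ (proj₂ (H j base≤j j≤m)))

    G₂≉0 : NonzeroOnRange G₂
    G₂≉0 j base≤j j≤m = proj₂ (proj₂ (proj₂ (H j base≤j j≤m)))

    module ΠF₁ = PartialProducts F₁ F₁≉0
    module ΠF₂ = PartialProducts F₂ F₂≉0
    module ΠG₁ = PartialProducts G₁ G₁≉0
    module ΠG₂ = PartialProducts G₂ G₂≉0

    summand≈ΔT : ∀ i → i <ℕ suc (m ℕ.+ n) → summand (base +ℤ + i) ≈ T (suc i) - T i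
    summand≈ΔT i i<N = begin
      summand k
        ≈⟨ *-cong (*-congˡ (/-cong P₂F₂≉0 (ΠF₁.prodZ≈P i ≡.refl) (ΠF₂.prodZ≈P*A i)))
                  (/-cong P₁G₁≉0 (ΠG₂.prodZ≈P i ≡.refl) (ΠG₁.prodZ≈P*A i)) ⟩
      fα α β (a k) (b k) * gα α β (c k) (d k)
        * (P F₁ i / (P F₂ i * F₂ k)) * (P G₂ i / (P G₁ i * G₁ k))
        ≈⟨ *-congʳ (*-congʳ (fα-gα-three-term (a k) (b≉0 k) (c≉0 k) (d≉0 k))) ⟨
      (F₁ k * G₂ k - F₂ k * G₁ k) * (P F₁ i / (P F₂ i * F₂ k)) * (P G₂ i / (P G₁ i * G₁ k))
        ≈⟨ ratio-product-increment (ΠF₂.P≉0 i i≤N) (ΠG₁.P≉0 i i≤N) F₂k≉0 G₁k≉0 ⟩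
      P F₁ i * F₁ k / (P F₂ i * F₂ k) * (P G₂ i * G₂ k / (P G₁ i * G₁ k)) - T i
        ≈⟨ +-congʳ (*-cong (/-cong P₂F₂≉0 (ΠF₁.P-suc i) (ΠF₂.P-suc i))
                           (/-cong P₁G₁≉0 (ΠG₂.P-suc i) (ΠG₁.P-suc i))) ⟨
      T (suc i) - T i
        ∎
      where
      k : ℤ
      k = base +ℤ + i
      i≤m+n : i ≤ℕ m ℕ.+ n
      i≤m+n = ℕ.s≤s⁻¹ i<N
      i≤N : i ≤ℕ suc (m ℕ.+ n)
      i≤N = ℕ.m≤n⇒m≤1+n i≤m+n
      F₂k≉0 : F₂ k ≉ 0#
      F₂k≉0 = ΠF₂.A[base+i]≉0 i i≤m+n
      G₁k≉0 : G₁ k ≉ 0#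
      G₁k≉0 = ΠG₁.A[base+i]≉0 i i≤m+n
      P₂F₂≉0 : P F₂ i * F₂ k ≉ 0#
      P₂F₂≉0 = x*y≉0 (ΠF₂.P≉0 i i≤N) F₂k≉0
      P₁G₁≉0 : P G₁ i * G₁ k ≉ 0#
      P₁G₁≉0 = x*y≉0 (ΠG₁.P≉0 i i≤N) G₁k≉0

    T-last : T (suc (m ℕ.+ n)) ≈ (prodZ F₁ (+ 1) (+ m) / prodZ F₂ (+ 1) (+ m))
                                 * (prodZ G₂ (+ 1) (+ m) / prodZ G₁ (+ 1) (+ m))
    T-last = sym (*-cong (/-cong (ΠF₂.P≉0 N ℕ.≤-refl) (ΠF₁.prodZ≈P N m≡) (ΠF₂.prodZ≈P N m≡))
                         (/-cong (ΠG₁.P≉0 N ℕ.≤-refl) (ΠG₂.prodZ≈P N m≡) (ΠG₁.prodZ≈P N m≡)))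
      where
      N : ℕ
      N = suc (m ℕ.+ n)
      x≡[-y+[1+[x+y]]]-1 : ∀ x y → x ≡.≡ (-ℤ y +ℤ (+ 1 +ℤ (x +ℤ y))) -ℤ + 1
      x≡[-y+[1+[x+y]]]-1 = solve-∀
      m≡ : + m ≡.≡ (base +ℤ + N) -ℤ + 1
      m≡ = ≡.trans (x≡[-y+[1+[x+y]]]-1 (+ m) (+ n))
                   (≡.cong (λ l → (base +ℤ (+ 1 +ℤ l)) -ℤ + 1) (≡.sym (ℤ.pos-+ m n)))

    T-first : T 0 ≈ (prodZ F₂ base (+ 0) / prodZ F₁ base (+ 0))
                    * (prodZ G₁ base (+ 0) / prodZ G₂ base (+ 0))
    T-first = begin
      T 0
        ≈⟨ *-cong ([1/x]/[1/y]≈y/x ΠF₂.prodUp[1+n]≉0) ([1/x]/[1/y]≈y/x ΠG₁.prodUp[1+n]≉0) ⟩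
      (prodUp F₂ base (suc n) / prodUp F₁ base (suc n))
        * (prodUp G₁ base (suc n) / prodUp G₂ base (suc n))
        ≡⟨ ≡.cong₂ _*_ (≡.cong₂ _/_ ΠF₂.prodZ[base,0]≡prodUp ΠF₁.prodZ[base,0]≡prodUp)
                       (≡.cong₂ _/_ ΠG₁.prodZ[base,0]≡prodUp ΠG₂.prodZ[base,0]≡prodUp) ⟨
      (prodZ F₂ base (+ 0) / prodZ F₁ base (+ 0)) * (prodZ G₁ base (+ 0) / prodZ G₂ base (+ 0))
        ∎

corollary3p6 : ∀ {c ℓ} (F : Field c ℓ) → let open Field F in
    (α β : Carrier) → ¬ (α ≈ 0#) →
    (a b c d : ℤ → Carrier) →
    (∀ j → ¬ (b j ≈ 0#)) → (∀ j → ¬ (c j ≈ 0#)) → (∀ j → ¬ (d j ≈ 0#)) →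
    (m n : ℕ) →
    (∀ j → -ℤ (+ n) ≤ j → j ≤ + m →
      ¬ (fα α β (a j) (c j) ≈ 0#) × ¬ (fα α β (a j) (d j) ≈ 0#) ×
      ¬ (gα α β (b j) (c j) ≈ 0#) × ¬ (gα α β (b j) (d j) ≈ 0#)) →
    let F₁ = λ j → fα α β (a j) (c j)
        F₂ = λ j → fα α β (a j) (d j)
        G₁ = λ j → gα α β (b j) (c j)
        G₂ = λ j → gα α β (b j) (d j)
    in sumRange (λ k → fα α β (a k) (b k) * gα α β (c k) (d k)
                  * (prodZ F₁ (+ 1) (k -ℤ + 1) / prodZ F₂ (+ 1) k)
                  * (prodZ G₂ (+ 1) (k -ℤ + 1) / prodZ G₁ (+ 1) k)) m n
       ≈ (prodZ F₁ (+ 1) (+ m) / prodZ F₂ (+ 1) (+ m))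
           * (prodZ G₂ (+ 1) (+ m) / prodZ G₁ (+ 1) (+ m))
         - (prodZ F₂ (-ℤ (+ n)) (+ 0) / prodZ F₁ (-ℤ (+ n)) (+ 0))
           * (prodZ G₁ (-ℤ (+ n)) (+ 0) / prodZ G₂ (-ℤ (+ n)) (+ 0))
corollary3p6 F α β α≉0 a b c d b≉0 c≉0 d≉0 m n H =
  trans (sumUp-telescope summand T base (suc (m ℕ.+ n)) summand≈ΔT) (+-cong T-last (-‿cong T-first))
  where
  open Field F
  open FieldProperties F
  open SummationFormula F α β α≉0 a b c d b≉0 c≉0 d≉0 m n H
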